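{- Let $f=f(x_1,\ldots,x_n)$ be a positive Boolean function and $i\in[n]$. Then (1) for every maximal zero $a$ of $f$ corresponding to $x_i$ there exists a minimal one $b$ of $f$ corresponding to $x_i$ such that $(a,b)$ is an $x_i$-extremal pair for $f$; and (2) for every minimal one $b$ of $f$ corresponding to $x_i$ there exists a maximal zero $a$ of $f$ corresponding to $x_i$ such that $(a,b)$ is an $x_i$-extremal pair for $f$.
   Context: $B=\{0,1\}$; for $x,y\in B^n$, $x\preceq y$ means $(x)_i=1$ implies $(y)_i=1$. $f$ is positive if $f(x)=1$ and $x\preceq y$ imply $f(y)=1$. A maximal zero of $f$ is a $\preceq$-maximal point with $f=0$; a minimal one is a $\preceq$-minimal point with $f=1$. A maximal zero $a$ corresponds to $x_i$ if $(a)_i=0$; a minimal one $b$ corresponds to $x_i$ if $(b)_i=1$. A pair $(a,b)$ is $x_i$-extremal for $f$ if $a$ is a maximal zero of $f$ corresponding to $x_i$, $b$ is a minimal one of $f$ corresponding to $x_i$, and $(a)_j\ge (b)_j$ for every $j\in[n]\setminus\{i\}$. -}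

module Defs where

open import Data.Bool using (Bool; true; false)
open import Data.Fin using (Fin)
open import Data.Product using (_×_)
open import Relation.Binary.PropositionalEquality using (_≡_; _≢_)
open import Relation.Nullary using (¬_)

Point : (n : _) → Set
Point n = Fin n → Bool

BoolFun : (n : _) → Set
BoolFun n = Point n → Bool

_⪯_ : {n : _} → Point n → Point n → Set
x ⪯ y = ∀ i → x i ≡ true → y i ≡ true

data _≤ᵇ_ : Bool → Bool → Set where
  f≤b : ∀ {b} → false ≤ᵇ b
  t≤t : true ≤ᵇ true

Positive : {n : _} → BoolFun n → Set
Positive f = ∀ x y → f x ≡ true → x ⪯ y → f y ≡ true

MaximalZero : {n : _} → BoolFun n → Point n → Set
MaximalZero f a = f a ≡ false × (∀ y → a ⪯ y → f y ≡ false → y ⪯ a)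

MinimalOne : {n : _} → BoolFun n → Point n → Set
MinimalOne f b = f b ≡ true × (∀ y → y ⪯ b → f y ≡ true → b ⪯ y)

Extremal : {n : _} → BoolFun n → Fin n → Point n → Point n → Set
Extremal f i a b =
  (MaximalZero f a × a i ≡ false) ×
  (MinimalOne f b × b i ≡ true) ×
  (∀ j → j ≢ i → b j ≤ᵇ a j)

-- If a is a maximal zero with a_i = 0, maximality makes a[i:=1] a one; any minimal one
-- b below it must have b_i = 1 (otherwise b ⪯ a and f a = 1), and b ⪯ a off i. A minimal
-- one below a given one is found by a single greedy pass lowering coordinates while f
-- stays 1; positivity makes the result minimal. Part (2) is part (1) for the dual
-- function x ↦ ¬ f(¬ x), which is positive and exchanges minimal ones and maximal zeros.
module Submission where

open import Defs
open import Data.Nat using (ℕ)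
open import Data.Bool using (Bool; true; false; not)
open import Data.Bool.Properties using (not-involutive; not-injective)
open import Data.Fin using (Fin; _≟_)
open import Data.List using (List; []; _∷_; allFin)
open import Data.List.Relation.Unary.All as All using (All; []; _∷_)
open import Data.List.Membership.Propositional.Properties using (∈-allFin)
open import Data.Product using (_×_; Σ; _,_)
open import Data.Vec.Functional using (updateAt)
open import Data.Vec.Functional.Properties using (updateAt-updates; updateAt-minimal)
open import Function using (_∘_; const)
open import Relation.Nullary using (yes; no; contradiction)
open import Relation.Binary.PropositionalEquality
  using (_≡_; _≢_; _≗_; refl; sym; trans; cong; subst)

private
  variable
    n : ℕ

infixl 30 _[_]≔_

_[_]≔_ : Point n → Fin n → Bool → Point n
x [ k ]≔ c = updateAt x k (const c)

∁ : Point n → Point n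
∁ x = not ∘ x

⪯-refl : {x : Point n} → x ⪯ x
⪯-refl _ xi = xi

⪯-trans : {x y z : Point n} → x ⪯ y → y ⪯ z → x ⪯ z
⪯-trans x⪯y y⪯z i xi = y⪯z i (x⪯y i xi)

≗⇒⪯ : {x y : Point n} → x ≗ y → x ⪯ y
≗⇒⪯ x≗y i xi = trans (sym (x≗y i)) xi

⪯⇒≤ᵇ : {x y : Point n} → x ⪯ y → ∀ j → x j ≤ᵇ y j
⪯⇒≤ᵇ {x = x} x⪯y j with x j in xj
... | false = f≤b
... | true  = subst (true ≤ᵇ_) (sym (x⪯y j xj)) t≤t

⪯-[]≔⁺ : {x y : Point n} {k : Fin n} {c : Bool} → y ⪯ x → y k ≡ false → y ⪯ x [ k ]≔ c
⪯-[]≔⁺ {x = x} {k = k} y⪯x yk j yj with j ≟ k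
... | yes refl = contradiction (trans (sym yj) yk) λ ()
... | no  j≢k  = trans (updateAt-minimal j k x j≢k) (y⪯x j yj)

⪯-[]≔⁻ : {x y : Point n} {k : Fin n} {c : Bool} → y ⪯ x [ k ]≔ c → y k ≡ false → y ⪯ x
⪯-[]≔⁻ {x = x} {k = k} y⪯x yk j yj with j ≟ k
... | yes refl = contradiction (trans (sym yj) yk) λ ()
... | no  j≢k  = trans (sym (updateAt-minimal j k x j≢k)) (y⪯x j yj)

x⪯x[k]≔true : (x : Point n) (k : Fin n) → x ⪯ x [ k ]≔ true
x⪯x[k]≔true x k j xj with j ≟ k
... | yes refl = updateAt-updates k x
... | no  j≢k  = trans (updateAt-minimal j k x j≢k) xj

x[k]≔false⪯x : (x : Point n) (k : Fin n) → x [ k ]≔ false ⪯ x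
x[k]≔false⪯x x k = ⪯-[]≔⁻ ⪯-refl (updateAt-updates k x)

∁-antitone : {x y : Point n} → x ⪯ y → ∁ y ⪯ ∁ x
∁-antitone {x = x} {y} x⪯y i ¬yi with x i in xi
... | false = refl
... | true  = trans (cong not (sym (x⪯y i xi))) ¬yi

∁-involutive : (x : Point n) → ∁ (∁ x) ≗ x
∁-involutive x i = not-involutive (x i)

≤ᵇ-not : {b c : Bool} → b ≤ᵇ not c → c ≤ᵇ not b
≤ᵇ-not {true}  {false} t≤t = f≤b
≤ᵇ-not {false} {false} f≤b = f≤b
≤ᵇ-not {false} {true}  f≤b = t≤t

dual : BoolFun n → BoolFun n
dual f = not ∘ f ∘ ∁

module _ {f : BoolFun n} (pos : Positive f) where

  positive-false : {x y : Point n} → f y ≡ false → x ⪯ y → f x ≡ false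
  positive-false {x} {y} fy x⪯y with f x in fx
  ... | false = refl
  ... | true  = trans (sym (pos x y fx x⪯y)) fy

  positive-resp-≗ : {x y : Point n} → x ≗ y → f x ≡ f y
  positive-resp-≗ {x} {y} x≗y with f y in fy
  ... | true  = pos y x fy (≗⇒⪯ (sym ∘ x≗y))
  ... | false = positive-false fy (≗⇒⪯ x≗y)

  dual-positive : Positive (dual f)
  dual-positive x y dfx x⪯y =
    cong not (positive-false (not-injective dfx) (∁-antitone x⪯y))

  MinimalOne⇒MaximalZero-dual : {b : Point n} → MinimalOne f b → MaximalZero (dual f) (∁ b)
  MinimalOne⇒MaximalZero-dual {b} (fb , b-min) =
    cong not (trans (positive-resp-≗ (∁-involutive b)) fb) , maximal
    where
    maximal : ∀ y → ∁ b ⪯ y → dual f y ≡ false → y ⪯ ∁ b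
    maximal y ∁b⪯y dfy =
      ⪯-trans (≗⇒⪯ (sym ∘ ∁-involutive y))
        (∁-antitone (b-min (∁ y) (⪯-trans (∁-antitone ∁b⪯y) (≗⇒⪯ (∁-involutive b)))
                           (not-injective dfy)))

  MinimalOne-dual⇒MaximalZero : {b : Point n} → MinimalOne (dual f) b → MaximalZero f (∁ b)
  MinimalOne-dual⇒MaximalZero {b} (dfb , b-min) = not-injective dfb , maximal
    where
    maximal : ∀ y → ∁ b ⪯ y → f y ≡ false → y ⪯ ∁ b
    maximal y ∁b⪯y fy =
      ⪯-trans (≗⇒⪯ (sym ∘ ∁-involutive y))
        (∁-antitone (b-min (∁ y) (⪯-trans (∁-antitone ∁b⪯y) (≗⇒⪯ (∁-involutive b)))
                           (cong not (trans (positive-resp-≗ (∁-involutive y)) fy))))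

  LocallyMinimalAt : Point n → Fin n → Set
  LocallyMinimalAt y k = y k ≡ true → f (y [ k ]≔ false) ≡ false

  locallyMinimal-⪯ : {y z : Point n} {k : Fin n} → z ⪯ y → LocallyMinimalAt y k → LocallyMinimalAt z k
  locallyMinimal-⪯ {y} {z} {k} z⪯y y-lm zk =
    positive-false (y-lm (z⪯y k zk))
      (⪯-[]≔⁺ (⪯-trans (x[k]≔false⪯x z k) z⪯y) (updateAt-updates k z))

  greedy-descent : {x : Point n} (ks : List (Fin n)) → f x ≡ true →
    Σ (Point n) λ y → y ⪯ x × f y ≡ true × All (LocallyMinimalAt y) ks
  greedy-descent [] fx = _ , ⪯-refl , fx , []
  greedy-descent (k ∷ ks) fx with greedy-descent ks fx
  ... | y , y⪯x , fy , y-lm with f (y [ k ]≔ false) in fy′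
  ... | true  = y [ k ]≔ false , ⪯-trans (x[k]≔false⪯x y k) y⪯x , fy′ ,
                (λ zk → contradiction (trans (sym zk) (updateAt-updates k y)) λ ())
                ∷ All.map (locallyMinimal-⪯ (x[k]≔false⪯x y k)) y-lm
  ... | false = y , y⪯x , fy , (λ _ → fy′) ∷ y-lm

  locallyMinimal⇒MinimalOne : {y : Point n} → f y ≡ true → (∀ k → LocallyMinimalAt y k) → MinimalOne f y
  locallyMinimal⇒MinimalOne {y} fy y-lm = fy , minimal
    where
    minimal : ∀ z → z ⪯ y → f z ≡ true → y ⪯ z
    minimal z z⪯y fz k yk with z k in zk
    ... | true  = refl
    ... | false = contradiction (trans (sym (pos z _ fz (⪯-[]≔⁺ z⪯y zk))) (y-lm k yk)) λ ()

  minimalOne-below : {x : Point n} → f x ≡ true → Σ (Point n) λ b → b ⪯ x × MinimalOne f b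
  minimalOne-below fx with greedy-descent (allFin _) fx
  ... | y , y⪯x , fy , y-lm =
    y , y⪯x , locallyMinimal⇒MinimalOne fy (λ k → All.lookup y-lm (∈-allFin k))

  MaximalZero-[]≔true : {a : Point n} {i : Fin n} → MaximalZero f a → a i ≡ false →
    f (a [ i ]≔ true) ≡ true
  MaximalZero-[]≔true {a} {i} (_ , a-max) ai with f (a [ i ]≔ true) in fa′
  ... | true  = refl
  ... | false =
    contradiction (trans (sym (a-max _ (x⪯x[k]≔true a i) fa′ i (updateAt-updates i a))) ai) λ ()

  maximalZero⇒extremal : (i : Fin n) (a : Point n) → MaximalZero f a → a i ≡ false →
    Σ (Point n) λ b → MinimalOne f b × b i ≡ true × Extremal f i a b
  maximalZero⇒extremal i a a-maxZero@(fa , _) ai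
    with minimalOne-below (MaximalZero-[]≔true a-maxZero ai)
  ... | b , b⪯ , b-minOne@(fb , _) =
    b , b-minOne , bi , (a-maxZero , ai) , (b-minOne , bi) , b≤a
    where
    bi : b i ≡ true
    bi with b i in bi′
    ... | true  = refl
    ... | false = contradiction (trans (sym (pos b a fb (⪯-[]≔⁻ b⪯ bi′))) fa) λ ()
    b≤a : ∀ j → j ≢ i → b j ≤ᵇ a j
    b≤a j j≢i = subst (b j ≤ᵇ_) (updateAt-minimal j i a j≢i) (⪯⇒≤ᵇ b⪯ j)

minimalOne⇒extremal : {f : BoolFun n} → Positive f → (i : Fin n) (b : Point n) →
  MinimalOne f b → b i ≡ true →
  Σ (Point n) λ a → MaximalZero f a × a i ≡ false × Extremal f i a b
minimalOne⇒extremal {f = f} pos i b b-minOne bi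
  with maximalZero⇒extremal (dual-positive pos) i (∁ b)
         (MinimalOne⇒MaximalZero-dual pos b-minOne) (cong not bi)
... | b′ , b′-minOne , b′i , _ , _ , b′≤∁b =
  ∁ b′ , a-maxZero , cong not b′i , (a-maxZero , cong not b′i) , (b-minOne , bi) ,
  λ j j≢i → ≤ᵇ-not (b′≤∁b j j≢i)
  where
  a-maxZero : MaximalZero f (∁ b′)
  a-maxZero = MinimalOne-dual⇒MaximalZero pos b′-minOne

claim1 : (n : ℕ) (f : BoolFun n) → Positive f → (i : Fin n) →
    ((a : Point n) → MaximalZero f a → a i ≡ false →
      Σ (Point n) (λ b → MinimalOne f b × b i ≡ true × Extremal f i a b))
    ×
    ((b : Point n) → MinimalOne f b → b i ≡ true →
      Σ (Point n) (λ a → MaximalZero f a × a i ≡ false × Extremal f i a b))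
claim1 _ _ pos i = maximalZero⇒extremal pos i , minimalOne⇒extremal pos i
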